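{- Let $k\ge2$, $n\ge1$. For every $(x,L)\in\mathbb R_{\ge0}^n\times\mathfrak L^n$, the function $\overline{(x,L)}:\mathfrak T^n\to\mathbb R$ is $k$-supermodular, i.e. $\overline{(x,L)}(T\sqcap U)+\overline{(x,L)}(T\sqcup U)\ge\overline{(x,L)}(T)+\overline{(x,L)}(U)$ for all $T,U\in\mathfrak T^n$.
   Context: $\mathfrak T$ is a set consisting of a root $\mathbf o$ and a set $\mathfrak L$ of exactly $k$ leaves. Binary operations $\sqcap,\sqcup$ on $\mathfrak T$: $t\sqcap t=t\sqcup t=t$; for distinct leaves $a,b$: $a\sqcap b=a\sqcup b=\mathbf o$; for a leaf $a$: $a\sqcap\mathbf o=\mathbf o\sqcap a=\mathbf o$, $a\sqcup\mathbf o=\mathbf o\sqcup a=a$; they act componentwise on $\mathfrak T^n$. For $(x,L)\in\mathbb R_{\ge0}^n\times\mathfrak L^n$, $\overline{(x,L)}(T)=\sum_{i=1}^n\overline{(x,L)}_i(T_i)$ with $\overline{(x,L)}_i(\mathbf o)=0$, $\overline{(x,L)}_i(L_i)=x_i$, $\overline{(x,L)}_i(\ell)=-x_i$ for leaves $\ell\ne L_i$. -}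

module Defs where

open import Level using (Level) renaming (suc to lsuc; _⊔_ to _⊔ℓ_)
open import Data.Nat using (ℕ; zero; suc)
open import Data.Fin using (Fin) renaming (zero to fz; suc to fs)
open import Data.Fin.Properties using (_≟_)
open import Data.Maybe using (Maybe; just; nothing)
open import Data.Product using (Σ; _×_; ∃)
open import Relation.Nullary using (¬_; yes; no)
open import Relation.Binary using (Rel; IsTotalOrder)
open import Algebra.Bundles using (CommutativeRing)

-- The real numbers, axiomatised: a (Dedekind-)complete ordered field.
-- agda-stdlib has no ℝ; we quantify over every structure satisfying the
-- axioms of a complete ordered field (ℝ is, up to isomorphism, the unique one).

record CompleteOrderedField c ℓ₁ ℓ₂ : Set (lsuc (c ⊔ℓ ℓ₁ ⊔ℓ ℓ₂)) where
  field
    commutativeRing : CommutativeRing c ℓ₁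
  open CommutativeRing commutativeRing public
  infix 4 _≤_
  field
    _≤_         : Rel Carrier ℓ₂
    isTotalOrder : IsTotalOrder _≈_ _≤_
    +-mono-≤    : ∀ {x y} z → x ≤ y → x + z ≤ y + z
    *-nonneg    : ∀ {x y} → 0# ≤ x → 0# ≤ y → 0# ≤ x * y
    0≉1         : ¬ (0# ≈ 1#)
    inverse     : ∀ x → ¬ (x ≈ 0#) → Σ Carrier (λ y → x * y ≈ 1#)
    sup         : (P : Carrier → Set c) → Σ Carrier P →
                  Σ Carrier (λ b → ∀ y → P y → y ≤ b) →
                  Σ Carrier (λ s → (∀ y → P y → y ≤ s) ×
                                   (∀ b → (∀ y → P y → y ≤ b) → s ≤ b))

-- The star tree 𝔗 with root 𝐨 and k leaves 𝔏 = Fin k.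
-- nothing = root 𝐨,  just a = leaf a.

Leaf : ℕ → Set
Leaf k = Fin k

Tree : ℕ → Set
Tree k = Maybe (Fin k)

root : ∀ {k} → Tree k
root = nothing

_⊓𝔗_ : ∀ {k} → Tree k → Tree k → Tree k
nothing ⊓𝔗 _       = nothing
just a  ⊓𝔗 nothing = nothing
just a  ⊓𝔗 just b with a ≟ b
... | yes _ = just a
... | no  _ = nothing

_⊔𝔗_ : ∀ {k} → Tree k → Tree k → Tree k
nothing ⊔𝔗 t       = t
just a  ⊔𝔗 nothing = just a
just a  ⊔𝔗 just b with a ≟ b
... | yes _ = just a
... | no  _ = nothing

_⊓_ : ∀ {k n} → (Fin n → Tree k) → (Fin n → Tree k) → (Fin n → Tree k)
(T ⊓ U) i = T i ⊓𝔗 U i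

_⊔_ : ∀ {k n} → (Fin n → Tree k) → (Fin n → Tree k) → (Fin n → Tree k)
(T ⊔ U) i = T i ⊔𝔗 U i

module _ {c ℓ₁ ℓ₂} (R : CompleteOrderedField c ℓ₁ ℓ₂) where
  open CompleteOrderedField R

  Σ[_] : ∀ n → (Fin n → Carrier) → Carrier
  Σ[ zero  ] f = 0#
  Σ[ suc n ] f = f fz + Σ[ n ] (λ i → f (fs i))

  barCoord : ∀ {k} → Carrier → Fin k → Tree k → Carrier
  barCoord x l nothing = 0#
  barCoord x l (just a) with a ≟ l
  ... | yes _ = x
  ... | no  _ = - x

  bar : ∀ {k n} → (Fin n → Carrier) → (Fin n → Leaf k) →
        (Fin n → Tree k) → Carrier
  bar {n = n} x L T = Σ[ n ] (λ i → barCoord (x i) (L i) (T i))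

  KSupermodular : ∀ {k n} → ((Fin n → Tree k) → Carrier) → Set ℓ₂
  KSupermodular f = ∀ T U → f T + f U ≤ f (T ⊓ U) + f (T ⊔ U)

module Submission where

-- The function \overline{(x,L)} is a sum over the n coordinates
-- of the one-variable functions \overline{(x,L)}_i : 𝔗 → ℝ, and ⊓, ⊔ act
-- coordinatewise on 𝔗ⁿ.  Supermodularity is preserved by such sums, since
-- inequalities can be added in an ordered abelian group.  So it suffices to
-- show that each coordinate function g = \overline{(x,L)}_i is supermodular
-- on the star tree 𝔗, i.e. g t + g u ≤ g (t ⊓ u) + g (t ⊔ u).  If t or u is
-- the root, or t = u, the two sides consist of the same terms.  Otherwise
-- t, u are distinct leaves, so t ⊓ u = t ⊔ u = 𝐨 and the right side is 0;
-- the left side is x - x = 0 when one of them is the marked leaf L_i, and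
-- -x - x ≤ 0 when neither is (they cannot both be, being distinct).

open import Defs
open import Data.Nat using (ℕ; _≤_; zero; suc)
open import Data.Fin using (Fin) renaming (zero to fz; suc to fs)
open import Data.Fin.Properties using (_≟_)
open import Data.Maybe using (just; nothing)
open import Relation.Nullary using (yes; no; ¬_; contradiction)
open import Relation.Binary.PropositionalEquality using (_≡_; refl)
open import Relation.Binary.Structures using (IsTotalOrder)
import Algebra.Properties.CommutativeSemigroup as CommutativeSemigroupProperties

module Supermodularity {c ℓ₁ ℓ₂} (R : CompleteOrderedField c ℓ₁ ℓ₂) where
  open CompleteOrderedField R hiding (refl) renaming (_≤_ to _≤R_)
  open IsTotalOrder isTotalOrder
    using (≤-respʳ-≈; ≤-respˡ-≈)
    renaming (refl to ≤R-refl; trans to ≤R-trans; reflexive to ≤R-reflexive)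
  open CommutativeSemigroupProperties +-commutativeSemigroup using (interchange)

  +-mono₂ : ∀ {a b c d} → a ≤R b → c ≤R d → a + c ≤R b + d
  +-mono₂ {a} {b} {c} {d} a≤b c≤d =
    ≤R-trans (+-mono-≤ c a≤b)
          (≤-respˡ-≈ (+-comm c b) (≤-respʳ-≈ (+-comm d b) (+-mono-≤ b c≤d)))

  neg-nonpos : ∀ {x} → 0# ≤R x → - x ≤R 0#
  neg-nonpos {x} 0≤x =
    ≤-respˡ-≈ (+-identityˡ (- x)) (≤-respʳ-≈ (-‿inverseʳ x) (+-mono-≤ (- x) 0≤x))

  ≈0⇒≤0+0 : ∀ {y} → y ≈ 0# → y ≤R 0# + 0#
  ≈0⇒≤0+0 y≈0 = ≤R-reflexive (trans y≈0 (sym (+-identityʳ 0#)))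

  Supermodular𝔗 : ∀ {k} → (Tree k → Carrier) → Set ℓ₂
  Supermodular𝔗 g = ∀ t u → g t + g u ≤R g (t ⊓𝔗 u) + g (t ⊔𝔗 u)

  -- On two distinct leaves a ≠ b (where a ⊓ b = a ⊔ b = 𝐨) the coordinate
  -- function is supermodular: its values there sum to x - x or to -x - x,
  -- since a and b cannot both be the marked leaf l.
  barCoord-distinct-leaves : ∀ {k} x (l a b : Fin k) → 0# ≤R x → ¬ a ≡ b →
    barCoord R x l (just a) + barCoord R x l (just b) ≤R 0# + 0#
  barCoord-distinct-leaves x l a b 0≤x a≢b with a ≟ l | b ≟ l
  ... | yes refl | yes refl = contradiction refl a≢b
  ... | yes _    | no _     = ≈0⇒≤0+0 (-‿inverseʳ x)
  ... | no _     | yes _    = ≈0⇒≤0+0 (-‿inverseˡ x)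
  ... | no _     | no _     = +-mono₂ (neg-nonpos 0≤x) (neg-nonpos 0≤x)

  barCoord-supermodular : ∀ {k} x (l : Fin k) → 0# ≤R x →
    Supermodular𝔗 (barCoord R x l)
  barCoord-supermodular x l 0≤x nothing  u        = ≤R-refl
  barCoord-supermodular x l 0≤x (just a) nothing  = ≤R-reflexive (+-comm _ _)
  barCoord-supermodular x l 0≤x (just a) (just b) with a ≟ b
  ... | yes refl = ≤R-refl
  ... | no a≢b   = barCoord-distinct-leaves x l a b 0≤x a≢b

  sum-supermodular : ∀ {k} n (g : Fin n → Tree k → Carrier) →
    (∀ i → Supermodular𝔗 (g i)) →
    KSupermodular R (λ T → Σ[_] R n (λ i → g i (T i)))
  sum-supermodular zero    g g-super T U = ≤R-refl
  sum-supermodular (suc n) g g-super T U =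
    ≤-respˡ-≈ (sym (interchange _ _ _ _)) (≤-respʳ-≈ (interchange _ _ _ _)
      (+-mono₂ (g-super fz (T fz) (U fz))
               (sum-supermodular n (λ i → g (fs i)) (λ i → g-super (fs i))
                                 (λ i → T (fs i)) (λ i → U (fs i)))))

proposition1 : ∀ {c ℓ₁ ℓ₂} (R : CompleteOrderedField c ℓ₁ ℓ₂) →
    (k n : ℕ) → 2 ≤ k → 1 ≤ n →
    (x : Fin n → CompleteOrderedField.Carrier R) →
    (∀ i → CompleteOrderedField._≤_ R (CompleteOrderedField.0# R) (x i)) →
    (L : Fin n → Leaf k) →
    KSupermodular R (bar R x L)
proposition1 R k n _ _ x x≥0 L =
  sum-supermodular n (λ i → barCoord R (x i) (L i))
                     (λ i → barCoord-supermodular (x i) (L i) (x≥0 i))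
  where open Supermodularity R
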